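{- Let $n\ge 2$, let $y=y_1\cdots y_{2n-2}\in B_{n-1}$, and let $x=1\,(y_1+1)\cdots(y_{2n-2}+1)\,2n$. Suppose $x\in\mathsf{Pop}_{\mathrm{Weak}(B_n)}(\mathrm{Weak}(B_n))$, $|\mathscr{U}_{\mathrm{Weak}(B_n)}(x)|=n-1$, and $y\notin\mathsf{Pop}_{\mathrm{Weak}(B_{n-1})}(\mathrm{Weak}(B_{n-1}))$. Then there is some $1\le j\le n-1$ such that $x_1=1$; $x_i=2n-j+i-2$ for $2\le i\le j+1$; $x_i=i$ for $j+2\le i\le 2n-j-1$; $x_i=j+i-2n+2$ for $2n-j\le i\le 2n-1$; and $x_{2n}=2n$.
   Context: $B_m$ is the set of permutations $x=x_1\cdots x_{2m}$ of $\{1,\dots,2m\}$ with $x_i+x_{2m+1-i}=2m+1$ for all $i$; $\mathrm{Weak}(B_m)$ is $B_m$ with the right weak order ($x\le y$ iff every pair of values $a<b$ with $b$ before $a$ in $x$ also has $b$ before $a$ in $y$). For a finite lattice $M$, $\mathsf{Pop}_M(x)$ is the meet of $x$ and all elements it covers (in $\mathrm{Weak}(B_m)$: reverse each maximal descending run of $x$), and $\mathscr{U}_M(x)$ is the set of elements covering $x$; in $\mathrm{Weak}(B_m)$ one has $|\mathscr{U}(x)|=\#\{i\in\{1,\dots,m\}:x_i<x_{i+1}\}$. -}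

module Defs where

open import Data.Nat using (ℕ; zero; suc; _+_; _*_; _∸_; _≤_; _<_; _<?_)
open import Data.List using (List; []; _∷_; _++_; [_]; length; filter; map; upTo)
open import Data.Product using (Σ; _×_)
open import Relation.Binary.PropositionalEquality using (_≡_)
open import Relation.Nullary.Decidable using (⌊_⌋)
open import Data.Bool using (if_then_else_)

-- Words are lists of naturals, read with 1-based positions; out of range gives 0.
_!_ : List ℕ → ℕ → ℕ
[] ! _ = 0
(x ∷ xs) ! zero = 0
(x ∷ xs) ! suc zero = x
(x ∷ xs) ! suc (suc i) = xs ! suc i

B : ℕ → List ℕ → Set
B m x =
  (length x ≡ 2 * m)
  × (∀ i → 1 ≤ i → i ≤ 2 * m → (1 ≤ x ! i) × (x ! i ≤ 2 * m))
  × (∀ i j → 1 ≤ i → i ≤ 2 * m → 1 ≤ j → j ≤ 2 * m → x ! i ≡ x ! j → i ≡ j)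
  × (∀ i → 1 ≤ i → i ≤ 2 * m → x ! i + x ! (2 * m + 1 ∸ i) ≡ 2 * m + 1)

-- Pop in Weak(B_m): reverse each maximal descending run.
-- popAux acc xs : acc is the reversal of the current (descending) run,
-- so its head is the last element read.
popAux : List ℕ → List ℕ → List ℕ
popAux acc [] = acc
popAux [] (x ∷ xs) = popAux [ x ] xs
popAux (a ∷ acc) (x ∷ xs) =
  if ⌊ x <? a ⌋ then popAux (x ∷ a ∷ acc) xs else ((a ∷ acc) ++ popAux [ x ] xs)

pop : List ℕ → List ℕ
pop = popAux []

InPopImage : ℕ → List ℕ → Set
InPopImage m x = Σ (List ℕ) (λ z → B m z × (pop z ≡ x))

upCount : ℕ → List ℕ → ℕ
upCount m x = length (filter (λ i → x ! i <? x ! suc i) (map suc (upTo m)))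

extend : ℕ → List ℕ → List ℕ
extend n y = 1 ∷ (map suc y ++ [ 2 * n ])

{-# OPTIONS --safe #-}
-- Since x₁ = 1 < x₂, the n − 1 ascents among the first n positions of x leave a single descent, at
-- some position j + 1 with 1 ≤ j ≤ n − 1. By the symmetry y_i + y_{N+1−i} = N + 1 (N = 2n − 2), y
-- is then the concatenation of three increasing runs, of lengths j, k = N − 2j and j. Reversing each
-- run gives a word z ∈ B_{n−1} with Pop z = y as soon as consecutive reversed runs meet in ascents,
-- i.e. y₁ < y_{j+k} and y_{j+1} < y_N (only y₁ < y_N if k = 0); by symmetry these two conditions are
-- equivalent. So y ∉ Pop forces y_N < y_{j+1} (resp. y_N < y₁). The last run starts at a value ≥ 1,
-- so y_N ≥ j and the middle run starts above j. Pairing the entries of the middle run symmetrically,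
-- their lower bounds already add up to N + 1, so the run is j+1, …, j+k; then y₁ > y_{j+k} = j + k,
-- and the same pairing argument fixes the first run to j+k+1, …, N and the last one to 1, …, j.

module Submission where

open import Defs
open import Data.Empty using (⊥; ⊥-elim)
open import Data.List
  using (List; []; _∷_; _++_; [_]; length; map; filter; upTo; head; reverse; applyUpTo; applyDownFrom; _ʳ++_)
open import Data.List.Properties
  using (++-identityʳ; ++-assoc; map-++; length-map; length-++; length-upTo; length-applyDownFrom;
         map-applyDownFrom; reverse-applyUpTo; ʳ++-defn; filter-complete)
open import Data.List.Relation.Unary.All as All using (All)
open import Data.List.Relation.Unary.All.Properties using (all-filter)
open import Data.List.Relation.Unary.Linked as Linked using (Linked; []; [-]; _∷_)
open import Data.List.Membership.Propositional using (_∈_)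
open import Data.List.Membership.Propositional.Properties using (∈-map⁻; ∈-map⁺; ∈-upTo⁻; ∈-upTo⁺)
open import Data.List.Relation.Unary.Any using (here; there)
open import Data.Maybe using (just)
open import Data.Maybe.Relation.Binary.Connected using (Connected; just; just-nothing)
open import Data.Nat using (ℕ; zero; suc; _+_; _*_; _∸_; _≤_; _<_; _<?_; _≤?_; z≤n; s≤s; s≤s⁻¹)
open import Data.Nat.Properties
open import Data.Nat.Tactic.RingSolver using (solve-∀)
open import Data.Product using (Σ; _×_; _,_; proj₁; proj₂; ∃-syntax)
open import Function using (_∘_; _∘₂_)
open import Relation.Binary.PropositionalEquality hiding ([_])
open import Relation.Nullary using (¬_; yes; no; contradiction)
open import Relation.Unary using (Decidable)

open ≡-Reasoning

a+b≡c+d∧b≤d⇒c≤a : ∀ {a b c d} → a + b ≡ c + d → b ≤ d → c ≤ a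
a+b≡c+d∧b≤d⇒c≤a {a} {b} {c} {d} eq b≤d =
  +-cancelʳ-≤ b c a (subst (c + b ≤_) (sym eq) (+-monoʳ-≤ c b≤d))

a+b≡c+d∧b<d⇒c<a : ∀ {a b c d} → a + b ≡ c + d → b < d → c < a
a+b≡c+d∧b<d⇒c<a {a} {b} {c} eq b<d =
  a+b≡c+d∧b≤d⇒c≤a (trans (+-suc a b) (cong suc eq)) b<d

a+b≡c+d∧c≤a∧d≤b⇒a≡c : ∀ {a b c d} → a + b ≡ c + d → c ≤ a → d ≤ b → a ≡ c
a+b≡c+d∧c≤a∧d≤b⇒a≡c eq c≤a d≤b = ≤-antisym (a+b≡c+d∧b≤d⇒c≤a (sym eq) d≤b) c≤a

partner-bounds : ∀ {N a b} → a + b ≡ N + 1 → 1 ≤ a → a ≤ N → (1 ≤ b) × (b ≤ N)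
partner-bounds {N} {a} {b} a+b≡ 1≤a a≤N =
  a+b≡c+d∧b≤d⇒c≤a (trans (+-comm b a) (trans a+b≡ (+-comm N 1))) a≤N ,
  a+b≡c+d∧b≤d⇒c≤a (sym (trans (+-comm b a) a+b≡)) 1≤a

m<n⇒∃[o]m+1+o≡n : ∀ {m n} → m < n → ∃[ o ] m + suc o ≡ n
m<n⇒∃[o]m+1+o≡n {m} m<n = let o , m+1+o≡n = m≤n⇒∃[o]m+o≡n m<n in o , trans (+-suc m o) m+1+o≡n

+-suc-comm : ∀ a b → a + suc b ≡ b + suc a
+-suc-comm = solve-∀

a+b≡S∧a+c≡S⇒b≡c : ∀ {a b c S} → a + b ≡ S → a + c ≡ S → b ≡ c
a+b≡S∧a+c≡S⇒b≡c {a} eq eq' = +-cancelˡ-≡ a _ _ (trans eq (sym eq'))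

complement-sum : ∀ N {a} → a ≤ N → a + (N + 1 ∸ a) ≡ N + 1
complement-sum N a≤N = m+[n∸m]≡n (≤-trans a≤N (m≤m+n N 1))

!-∷ : ∀ x xs {i} → 1 ≤ i → (x ∷ xs) ! suc i ≡ xs ! i
!-∷ x xs {suc i} _ = refl

!-map : ∀ (f : ℕ → ℕ) xs {i} → suc i ≤ length xs → map f xs ! suc i ≡ f (xs ! suc i)
!-map f (x ∷ xs)     {zero}  _         = refl
!-map f (x ∷ y ∷ xs) {suc i} (s≤s i<) = !-map f (y ∷ xs) i<

!-++ˡ : ∀ xs ys {i} → suc i ≤ length xs → (xs ++ ys) ! suc i ≡ xs ! suc i
!-++ˡ (x ∷ xs)     ys {zero}  _         = refl
!-++ˡ (x ∷ y ∷ xs) ys {suc i} (s≤s i<) = !-++ˡ (y ∷ xs) ys i<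

!-++ʳ : ∀ xs ys {i} → (xs ++ ys) ! (length xs + suc i) ≡ ys ! suc i
!-++ʳ []       ys     = refl
!-++ʳ (x ∷ xs) ys {i} =
  trans (!-∷ x (xs ++ ys) (≤-trans (s≤s z≤n) (m≤n+m (suc i) (length xs)))) (!-++ʳ xs ys)

!-applyDownFrom : ∀ f {L t s} → t + suc s ≡ L → applyDownFrom f L ! suc t ≡ f s
!-applyDownFrom f {t = zero}  refl = refl
!-applyDownFrom f {t = suc t} refl = !-applyDownFrom f {t = t} refl

applyUpTo-! : ∀ xs → applyUpTo (λ t → xs ! suc t) (length xs) ≡ xs
applyUpTo-! []       = refl
applyUpTo-! (x ∷ xs) = cong (x ∷_) (applyUpTo-! xs)

applyUpTo-+ : ∀ (f : ℕ → ℕ) a b → applyUpTo f (a + b) ≡ applyUpTo f a ++ applyUpTo (λ t → f (a + t)) b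
applyUpTo-+ f zero    b = refl
applyUpTo-+ f (suc a) b = cong (f 0 ∷_) (applyUpTo-+ (f ∘ suc) a b)

popAux-push : ∀ {x acc} rest → Linked _<_ (x ∷ acc) → popAux acc (x ∷ rest) ≡ popAux (x ∷ acc) rest
popAux-push {acc = []}    rest _ = refl
popAux-push {x} {a ∷ acc} rest (x<a ∷ _) with x <? a
... | yes _   = refl
... | no x≮a = contradiction x<a x≮a

popAux-ʳ++ : ∀ xs {acc} rest → Linked _<_ (xs ++ acc) →
             popAux acc (xs ʳ++ rest) ≡ popAux (xs ++ acc) rest
popAux-ʳ++ []       rest _   = refl
popAux-ʳ++ (x ∷ xs) {acc} rest lnk = begin
  popAux acc (xs ʳ++ x ∷ rest)  ≡⟨ popAux-ʳ++ xs (x ∷ rest) (Linked.tail lnk) ⟩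
  popAux (xs ++ acc) (x ∷ rest) ≡⟨ popAux-push rest lnk ⟩
  popAux (x ∷ xs ++ acc) rest   ∎

popAux-flush : ∀ {c} acc rest → Connected _≤_ (just c) (head rest) →
               popAux (c ∷ acc) rest ≡ (c ∷ acc) ++ pop rest
popAux-flush acc []         _          = sym (++-identityʳ _)
popAux-flush {c} acc (x ∷ rest) (just c≤x) with x <? c
... | yes x<c = contradiction c≤x (<⇒≱ x<c)
... | no _    = refl

pop-ʳ++ : ∀ {x} xs rest → Linked _<_ (x ∷ xs) → Connected _≤_ (just x) (head rest) →
          pop ((x ∷ xs) ʳ++ rest) ≡ (x ∷ xs) ++ pop rest
pop-ʳ++ {x} xs rest lnk x≤rest = begin
  popAux [] ((x ∷ xs) ʳ++ rest)
    ≡⟨ popAux-ʳ++ (x ∷ xs) rest (subst (Linked _<_) (sym (++-identityʳ (x ∷ xs))) lnk) ⟩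
  popAux ((x ∷ xs) ++ []) rest
    ≡⟨ cong (λ acc → popAux acc rest) (++-identityʳ (x ∷ xs)) ⟩
  popAux (x ∷ xs) rest
    ≡⟨ popAux-flush xs rest x≤rest ⟩
  (x ∷ xs) ++ pop rest ∎

Increasing : (ℕ → ℕ) → ℕ → Set
Increasing f L = ∀ t → suc t < L → f t < f (suc t)

Linked-applyUpTo : ∀ f L → Increasing f L → Linked _<_ (applyUpTo f L)
Linked-applyUpTo f zero          _   = []
Linked-applyUpTo f (suc zero)    _   = [-]
Linked-applyUpTo f (suc (suc L)) inc =
  inc 0 (s≤s (s≤s z≤n)) ∷ Linked-applyUpTo (f ∘ suc) (suc L) (λ t → inc (suc t) ∘ s≤s)

pop-applyDownFrom-++ : ∀ f L rest → Increasing f L →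
                       (0 < L → Connected _≤_ (just (f 0)) (head rest)) →
                       pop (applyDownFrom f L ++ rest) ≡ applyUpTo f L ++ pop rest
pop-applyDownFrom-++ f zero    rest _   _        = refl
pop-applyDownFrom-++ f (suc L) rest inc junction = begin
  pop (applyDownFrom f (suc L) ++ rest)
    ≡⟨ cong (λ xs → pop (xs ++ rest)) (sym (reverse-applyUpTo f (suc L))) ⟩
  pop (reverse (applyUpTo f (suc L)) ++ rest)
    ≡⟨ cong pop (sym (ʳ++-defn (applyUpTo f (suc L)))) ⟩
  pop (applyUpTo f (suc L) ʳ++ rest)
    ≡⟨ pop-ʳ++ _ rest (Linked-applyUpTo f (suc L) inc) (junction (s≤s z≤n)) ⟩
  applyUpTo f (suc L) ++ pop rest ∎

B-pair : ∀ {m y a b} → B m y → 1 ≤ a → a ≤ 2 * m → a + b ≡ 2 * m + 1 → y ! a + y ! b ≡ 2 * m + 1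
B-pair {m} {y} {a} {b} (_ , _ , _ , symmetric) 1≤a a≤ a+b≡ =
  subst (λ c → y ! a + y ! c ≡ 2 * m + 1) partner (symmetric a 1≤a a≤)
  where
  partner : 2 * m + 1 ∸ a ≡ b
  partner = trans (cong (_∸ a) (sym a+b≡)) (m+n∸m≡n a b)

B-∘ : ∀ {m σ y} → B m σ → B m y → B m (map (y !_) σ)
B-∘ {m} {σ} {y} (length-σ , range-σ , injective-σ , symmetric-σ) By@(_ , range-y , injective-y , _) =
  trans (length-map _ σ) length-σ , range , injective , symmetric
  where
  at : ∀ {i} → 1 ≤ i → i ≤ 2 * m → map (y !_) σ ! i ≡ y ! (σ ! i)
  at {suc i} _ i≤ = !-map (y !_) σ (subst (suc i ≤_) (sym length-σ) i≤)

  range : ∀ i → 1 ≤ i → i ≤ 2 * m → (1 ≤ map (y !_) σ ! i) × (map (y !_) σ ! i ≤ 2 * m)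
  range i 1≤i i≤ rewrite at 1≤i i≤ = let 1≤σi , σi≤ = range-σ i 1≤i i≤ in range-y (σ ! i) 1≤σi σi≤

  injective : ∀ i i' → 1 ≤ i → i ≤ 2 * m → 1 ≤ i' → i' ≤ 2 * m →
              map (y !_) σ ! i ≡ map (y !_) σ ! i' → i ≡ i'
  injective i i' 1≤i i≤ 1≤i' i'≤ eq =
    let 1≤σi , σi≤ = range-σ i 1≤i i≤
        1≤σi' , σi'≤ = range-σ i' 1≤i' i'≤
    in injective-σ i i' 1≤i i≤ 1≤i' i'≤
         (injective-y (σ ! i) (σ ! i') 1≤σi σi≤ 1≤σi' σi'≤
           (trans (sym (at 1≤i i≤)) (trans eq (at 1≤i' i'≤))))

  symmetric : ∀ i → 1 ≤ i → i ≤ 2 * m → map (y !_) σ ! i + map (y !_) σ ! (2 * m + 1 ∸ i) ≡ 2 * m + 1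
  symmetric i 1≤i i≤ with 1≤i' , i'≤ ← partner-bounds (complement-sum (2 * m) i≤) 1≤i i≤
                        | 1≤σi , σi≤ ← range-σ i 1≤i i≤ = begin
    map (y !_) σ ! i + map (y !_) σ ! (2 * m + 1 ∸ i)
      ≡⟨ cong₂ _+_ (at 1≤i i≤) (at 1≤i' i'≤) ⟩
    y ! (σ ! i) + y ! (σ ! (2 * m + 1 ∸ i))
      ≡⟨ B-pair {m} {y} By 1≤σi σi≤ (symmetric-σ i 1≤i i≤) ⟩
    2 * m + 1 ∎

B-ascent-mirror : ∀ {m y i i'} → B m y → 1 ≤ i → 1 ≤ i' → i + i' ≡ 2 * m →
                  y ! i < y ! suc i → y ! i' < y ! suc i'
B-ascent-mirror {m} {y} {i} {i'} By 1≤i 1≤i' i+i'≡ ascent = a+b≡c+d∧b<d⇒c<a sums ascent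
  where
  2m+1≡ : suc (i + i') ≡ 2 * m + 1
  2m+1≡ = trans (cong suc i+i'≡) (+-comm 1 (2 * m))
  pair₁ : y ! i + y ! suc i' ≡ 2 * m + 1
  pair₁ = B-pair {m} {y} By 1≤i (subst (i ≤_) i+i'≡ (m≤m+n i i')) (trans (+-suc i i') 2m+1≡)
  pair₂ : y ! suc i + y ! i' ≡ 2 * m + 1
  pair₂ = B-pair {m} {y} By (s≤s z≤n)
    (subst (suc i ≤_) i+i'≡ (subst (_≤ i + i') (+-comm i 1) (+-monoʳ-≤ i 1≤i'))) 2m+1≡
  sums : y ! suc i' + y ! i ≡ y ! i' + y ! suc i
  sums = begin
    y ! suc i' + y ! i  ≡⟨ +-comm (y ! suc i') (y ! i) ⟩
    y ! i + y ! suc i'  ≡⟨ trans pair₁ (sym pair₂) ⟩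
    y ! suc i + y ! i'  ≡⟨ +-comm (y ! suc i) (y ! i') ⟩
    y ! i' + y ! suc i  ∎

position : ℕ → ℕ → ℕ
position o t = suc (o + t)

position-≤ : ∀ o {L t s} → t + suc s ≡ L → position o t ≤ o + L
position-≤ o {t = t} {s} refl = subst (_≤ o + (t + suc s)) (+-suc o t) (+-monoʳ-≤ o 1+t≤L)
  where
  1+t≤L : suc t ≤ t + suc s
  1+t≤L = subst (suc t ≤_) (sym (+-suc t s)) (s≤s (m≤m+n t s))

position-mirror : ∀ {o L o' N t s} → t + suc s ≡ L → o + L + o' ≡ N →
                  position o t + position o' s ≡ N + 1
position-mirror {o} {o' = o'} {t = t} {s} refl refl = identity o o' t s
  where
  identity : ∀ o o' t s → suc (o + t) + suc (o' + s) ≡ o + (t + suc s) + o' + 1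
  identity = solve-∀

-- Positions i and p are exchanged by reversing the block of positions o+1, …, o+L.
data Flip (o L i p : ℕ) : Set where
  flip : ∀ t s → t + suc s ≡ L → i ≡ position o t → p ≡ position o s → Flip o L i p

Flip-sym : ∀ {o L i p} → Flip o L i p → Flip o L p i
Flip-sym (flip t s split i≡ p≡) = flip s t (trans (+-suc-comm s t) split) p≡ i≡

Flip-functional : ∀ {o L i p p'} → Flip o L i p → Flip o L i p' → p ≡ p'
Flip-functional {o} (flip t s split refl refl) (flip t' s' split' i≡ refl) =
  cong (position o) (suc-injective (a+b≡S∧a+c≡S⇒b≡c split (trans (cong (_+ suc s') t≡t') split')))
  where
  t≡t' : t ≡ t'
  t≡t' = +-cancelˡ-≡ o _ _ (suc-injective i≡)

Flip-bounds : ∀ {o L i p} → Flip o L i p → o < i × i ≤ o + L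
Flip-bounds {o} (flip t s split refl _) = s≤s (m≤m+n o t) , position-≤ o split

Flip-disjoint : ∀ {o L o' L' i p p'} → Flip o L i p → Flip o' L' i p' → o + L ≤ o' → ⊥
Flip-disjoint f f' o+L≤o' = ≤⇒≯ (≤-trans (proj₂ (Flip-bounds f)) o+L≤o') (proj₁ (Flip-bounds f'))

Flip-mirror : ∀ {o L o' N i p i' p'} → o + L + o' ≡ N → Flip o L i p →
              i + i' ≡ N + 1 → p + p' ≡ N + 1 → Flip o' L i' p'
Flip-mirror {L = L} mirror (flip t s split refl refl) i+i'≡ p+p'≡ =
  flip s t split'
    (a+b≡S∧a+c≡S⇒b≡c i+i'≡ (position-mirror split mirror))
    (a+b≡S∧a+c≡S⇒b≡c p+p'≡ (position-mirror split' mirror))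
  where
  split' : s + suc t ≡ L
  split' = trans (+-suc-comm s t) split

data Reversed (j k i p : ℕ) : Set where
  first  : Flip 0 j i p       → Reversed j k i p
  middle : Flip j k i p       → Reversed j k i p
  last   : Flip (j + k) j i p → Reversed j k i p

Reversed-sym : ∀ {j k i p} → Reversed j k i p → Reversed j k p i
Reversed-sym (first f)  = first (Flip-sym f)
Reversed-sym (middle f) = middle (Flip-sym f)
Reversed-sym (last f)   = last (Flip-sym f)

Reversed-functional : ∀ {j k i p p'} → Reversed j k i p → Reversed j k i p' → p ≡ p'
Reversed-functional (first f)  (first f')  = Flip-functional f f'
Reversed-functional (middle f) (middle f') = Flip-functional f f'
Reversed-functional (last f)   (last f')   = Flip-functional f f'
Reversed-functional (first f)  (middle f') = ⊥-elim (Flip-disjoint f f' ≤-refl)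
Reversed-functional (middle f) (first f')  = ⊥-elim (Flip-disjoint f' f ≤-refl)
Reversed-functional {j} {k} (first f)  (last f') = ⊥-elim (Flip-disjoint f f' (m≤m+n j k))
Reversed-functional {j} {k} (last f)   (first f') = ⊥-elim (Flip-disjoint f' f (m≤m+n j k))
Reversed-functional (middle f) (last f')   = ⊥-elim (Flip-disjoint f f' ≤-refl)
Reversed-functional (last f)   (middle f') = ⊥-elim (Flip-disjoint f' f ≤-refl)

Reversed-injective : ∀ {j k i i' p} → Reversed j k i p → Reversed j k i' p → i ≡ i'
Reversed-injective r r' = Reversed-functional (Reversed-sym r) (Reversed-sym r')

Reversed-bounds : ∀ {j k i p} → Reversed j k i p → 1 ≤ i × i ≤ j + k + j
Reversed-bounds {j} {k} (first f) = let 0<i , i≤j = Flip-bounds f in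
  0<i , ≤-trans i≤j (≤-trans (m≤m+n j k) (m≤m+n (j + k) j))
Reversed-bounds {j} {k} (middle f) = let j<i , i≤ = Flip-bounds f in
  ≤-trans (s≤s z≤n) j<i , ≤-trans i≤ (m≤m+n (j + k) j)
Reversed-bounds {j} {k} (last f) = let j+k<i , i≤ = Flip-bounds f in
  ≤-trans (s≤s z≤n) j+k<i , i≤

Reversed-mirror : ∀ {j k N i p i' p'} → j + k + j ≡ N → Reversed j k i p →
                  i + i' ≡ N + 1 → p + p' ≡ N + 1 → Reversed j k i' p'
Reversed-mirror {j} {k} N≡ (first f) = last ∘₂ Flip-mirror (trans (+-comm j (j + k)) N≡) f
Reversed-mirror N≡ (middle f) = middle ∘₂ Flip-mirror N≡ f
Reversed-mirror {j} {k} N≡ (last f) = first ∘₂ Flip-mirror (trans (+-identityʳ (j + k + j)) N≡) f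

data Block (j k : ℕ) : ℕ → Set where
  first  : ∀ {t} → t < j → Block j k (position 0 t)
  middle : ∀ {t} → t < k → Block j k (position j t)
  last   : ∀ {t} → t < j → Block j k (position (j + k) t)

block : ∀ j k {i} → 1 ≤ i → i ≤ j + k + j → Block j k i
block j k {suc i} _ i< with i <? j
... | yes i<j = first i<j
... | no  i≮j with t , refl ← m≤n⇒∃[o]m+o≡n (≮⇒≥ i≮j) with t <? k
...   | yes t<k = middle t<k
...   | no  t≮k with u , refl ← m≤n⇒∃[o]m+o≡n (≮⇒≥ t≮k) =
  subst (Block j k) (cong suc (+-assoc j k u)) (last u<j)
  where
  u<j : u < j
  u<j = +-cancelˡ-< (j + k) u j (subst (_< j + k + j) (sym (+-assoc j k u)) i<)

Flip-applyDownFrom : ∀ o {L t} → t < L → Flip o L (position o t) (applyDownFrom (position o) L ! suc t)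
Flip-applyDownFrom o t<L = let s , split = m<n⇒∃[o]m+1+o≡n t<L in
  flip _ s split refl (!-applyDownFrom (position o) split)

Flip-at : ∀ o L pre rest {t} → length pre ≡ o → t < L →
          Flip o L (position o t) ((pre ++ applyDownFrom (position o) L ++ rest) ! position o t)
Flip-at o L pre rest {t} refl t<L = subst (Flip o L (position o t)) (sym at) (Flip-applyDownFrom o t<L)
  where
  D : List ℕ
  D = applyDownFrom (position o) L
  at : (pre ++ D ++ rest) ! position o t ≡ D ! suc t
  at = begin
    (pre ++ D ++ rest) ! suc (length pre + t)
      ≡⟨ cong ((pre ++ D ++ rest) !_) (sym (+-suc (length pre) t)) ⟩
    (pre ++ D ++ rest) ! (length pre + suc t)
      ≡⟨ !-++ʳ pre (D ++ rest) ⟩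
    (D ++ rest) ! suc t
      ≡⟨ !-++ˡ D rest (subst (t <_) (sym (length-applyDownFrom (position o) L)) t<L) ⟩
    D ! suc t ∎

module _ (j k : ℕ) where
  private
    D₁ D₂ D₃ : List ℕ
    D₁ = applyDownFrom (position 0) j
    D₂ = applyDownFrom (position j) k
    D₃ = applyDownFrom (position (j + k)) j

  blockReversal : List ℕ
  blockReversal = D₁ ++ D₂ ++ D₃

  length-blockReversal : length blockReversal ≡ j + k + j
  length-blockReversal = begin
    length (D₁ ++ D₂ ++ D₃)                 ≡⟨ length-++ D₁ ⟩
    length D₁ + length (D₂ ++ D₃)           ≡⟨ cong (length D₁ +_) (length-++ D₂) ⟩
    length D₁ + (length D₂ + length D₃)
      ≡⟨ cong₂ _+_ (length-applyDownFrom _ j) (cong₂ _+_ (length-applyDownFrom _ k) (length-applyDownFrom _ j)) ⟩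
    j + (k + j)                             ≡⟨ +-assoc j k j ⟨
    j + k + j                               ∎

  blockReversal-Reversed : ∀ {i} → 1 ≤ i → i ≤ j + k + j → Reversed j k i (blockReversal ! i)
  blockReversal-Reversed 1≤i i≤ with block j k 1≤i i≤
  ... | first t<j  = first (Flip-at 0 j [] (D₂ ++ D₃) refl t<j)
  ... | middle t<k = middle (Flip-at j k D₁ D₃ (length-applyDownFrom _ j) t<k)
  ... | last {t} t<j =
    last (subst (λ xs → Flip (j + k) j (position (j + k) t) (xs ! position (j + k) t)) regroup
                (Flip-at (j + k) j (D₁ ++ D₂) [] |D₁++D₂| t<j))
    where
    |D₁++D₂| : length (D₁ ++ D₂) ≡ j + k
    |D₁++D₂| = trans (length-++ D₁) (cong₂ _+_ (length-applyDownFrom _ j) (length-applyDownFrom _ k))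
    regroup : (D₁ ++ D₂) ++ D₃ ++ [] ≡ blockReversal
    regroup = trans (++-assoc D₁ D₂ (D₃ ++ [])) (cong (λ xs → D₁ ++ D₂ ++ xs) (++-identityʳ D₃))

  map-blockReversal : ∀ (f : ℕ → ℕ) → map f blockReversal ≡
    applyDownFrom (f ∘ position 0) j ++ applyDownFrom (f ∘ position j) k ++ applyDownFrom (f ∘ position (j + k)) j
  map-blockReversal f = begin
    map f (D₁ ++ D₂ ++ D₃)                  ≡⟨ map-++ f D₁ (D₂ ++ D₃) ⟩
    map f D₁ ++ map f (D₂ ++ D₃)            ≡⟨ cong (map f D₁ ++_) (map-++ f D₂ D₃) ⟩
    map f D₁ ++ map f D₂ ++ map f D₃
      ≡⟨ cong₂ _++_ (map-applyDownFrom _ f j) (cong₂ _++_ (map-applyDownFrom _ f k) (map-applyDownFrom _ f j)) ⟩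
    _ ∎

blockReversal-B : ∀ {m j k} → j + k + j ≡ 2 * m → B m (blockReversal j k)
blockReversal-B {m} {j} {k} N≡ = trans (length-blockReversal j k) N≡ , range , injective , symmetric
  where
  σ : List ℕ
  σ = blockReversal j k

  reversed : ∀ {i} → 1 ≤ i → i ≤ 2 * m → Reversed j k i (σ ! i)
  reversed {i} 1≤i i≤ = blockReversal-Reversed j k 1≤i (subst (i ≤_) (sym N≡) i≤)

  range : ∀ i → 1 ≤ i → i ≤ 2 * m → (1 ≤ σ ! i) × (σ ! i ≤ 2 * m)
  range i 1≤i i≤ = let 1≤σi , σi≤ = Reversed-bounds (Reversed-sym (reversed 1≤i i≤)) in
    1≤σi , subst (σ ! i ≤_) N≡ σi≤

  injective : ∀ i i' → 1 ≤ i → i ≤ 2 * m → 1 ≤ i' → i' ≤ 2 * m → σ ! i ≡ σ ! i' → i ≡ i'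
  injective i i' 1≤i i≤ 1≤i' i'≤ eq =
    Reversed-injective (reversed 1≤i i≤) (subst (Reversed j k i') (sym eq) (reversed 1≤i' i'≤))

  symmetric : ∀ i → 1 ≤ i → i ≤ 2 * m → σ ! i + σ ! (2 * m + 1 ∸ i) ≡ 2 * m + 1
  symmetric i 1≤i i≤ with 1≤i' , i'≤ ← partner-bounds (complement-sum (2 * m) i≤) 1≤i i≤
                        | _ , σi≤ ← range i 1≤i i≤ = begin
    σ ! i + σ ! (2 * m + 1 ∸ i)    ≡⟨ cong (σ ! i +_) partner ⟩
    σ ! i + (2 * m + 1 ∸ σ ! i)    ≡⟨ complement-sum (2 * m) σi≤ ⟩
    2 * m + 1                      ∎
    where
    partner : σ ! (2 * m + 1 ∸ i) ≡ 2 * m + 1 ∸ σ ! i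
    partner = Reversed-functional (reversed 1≤i' i'≤)
      (Reversed-mirror N≡ (reversed 1≤i i≤) (complement-sum (2 * m) i≤) (complement-sum (2 * m) σi≤))

Increasing⇒lower-bound : ∀ {f L c} → Increasing f L → c ≤ f 0 → ∀ {t} → t < L → c + t ≤ f t
Increasing⇒lower-bound {c = c} inc c≤f0 {zero}  _   = subst (_≤ _) (sym (+-identityʳ c)) c≤f0
Increasing⇒lower-bound {f} {c = c} inc c≤f0 {suc t} t<L = subst (_≤ f (suc t)) (sym (+-suc c t))
  (≤-<-trans (Increasing⇒lower-bound inc c≤f0 (<-trans (n<1+n t) t<L)) (inc t t<L))

-- The lower bounds c + t and c' + s of mirrored entries already add up to S, so both are attained.
Increasing-pinned : ∀ {f f' L c c' S} → Increasing f L → Increasing f' L → c ≤ f 0 → c' ≤ f' 0 →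
                    (∀ {t s} → t + suc s ≡ L → f t + f' s ≡ S) → c + c' + L ≡ suc S →
                    ∀ {t} → t < L → f t ≡ c + t
Increasing-pinned {f} {f'} {L} {c} {c'} {S} inc inc' c≤ c'≤ mirrored bound≡ {t} t<L =
  let s , split = m<n⇒∃[o]m+1+o≡n t<L in
  a+b≡c+d∧c≤a∧d≤b⇒a≡c (trans (mirrored split) (sym (bounds-sum split)))
    (Increasing⇒lower-bound inc c≤ t<L) (Increasing⇒lower-bound inc' c'≤ (subst (s <_) split (m≤n+m (suc s) t)))
  where
  bounds-sum : ∀ {s} → t + suc s ≡ L → c + t + (c' + s) ≡ S
  bounds-sum {s} split = suc-injective (trans (identity c c' t s) (trans (cong (c + c' +_) split) bound≡))
    where
    identity : ∀ c c' t s → suc (c + t + (c' + s)) ≡ c + c' + (t + suc s)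
    identity = solve-∀

BlockSwapped : ℕ → ℕ → List ℕ → Set
BlockSwapped j k y = (∀ {t} → t < j → y ! position 0 t ≡ position (j + k) t)
                   × (∀ {t} → t < k → y ! position j t ≡ position j t)
                   × (∀ {t} → t < j → y ! position (j + k) t ≡ position 0 t)

module RunReversal {m y} (By : B m y) (j₀ k : ℕ) (N≡ : suc j₀ + k + suc j₀ ≡ 2 * m)
  (ascent : ∀ i → 1 ≤ i → i < 2 * m → i ≢ suc j₀ → i ≢ suc j₀ + k → y ! i < y ! suc i) where

  j : ℕ
  j = suc j₀

  run : ℕ → ℕ → ℕ
  run o = (y !_) ∘ position o

  pair : ∀ o L o' {t s} → o + L + o' ≡ 2 * m → t + suc s ≡ L → run o t + run o' s ≡ 2 * m + 1
  pair o L o' mirror split =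
    B-pair {m} {y} By (s≤s z≤n) (≤-trans (position-≤ o split) (subst (o + L ≤_) mirror (m≤m+n (o + L) o')))
      (position-mirror split mirror)

  increasing : ∀ o L → o + L ≤ 2 * m → (∀ {t} → suc t < L → position o t ≢ j × position o t ≢ j + k) →
               Increasing (run o) L
  increasing o L o+L≤ avoids t 1+t<L =
    subst (λ p → run o t < y ! p) (cong suc (sym (+-suc o t)))
      (ascent (position o t) (s≤s z≤n) (<-≤-trans (subst (_< o + L) (+-suc o t) (+-monoʳ-< o 1+t<L)) o+L≤)
        (proj₁ (avoids 1+t<L)) (proj₂ (avoids 1+t<L)))

  within : ∀ {a} → a ≤ j + k + j → a ≤ 2 * m
  within {a} a≤ = subst (a ≤_) N≡ a≤

  increasing-first : Increasing (run 0) j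
  increasing-first = increasing 0 j (within (≤-trans (m≤m+n j k) (m≤m+n (j + k) j))) λ 1+t<j →
    <⇒≢ 1+t<j , <⇒≢ (<-≤-trans 1+t<j (m≤m+n j k))

  increasing-middle : Increasing (run j) k
  increasing-middle = increasing j k (within (m≤m+n (j + k) j)) λ {t} 1+t<k →
    >⇒≢ (s≤s (m≤m+n j t)) , <⇒≢ (subst (_< j + k) (+-suc j t) (+-monoʳ-< j 1+t<k))

  increasing-last : Increasing (run (j + k)) j
  increasing-last = increasing (j + k) j (within ≤-refl) λ {t} _ →
    >⇒≢ (s≤s (≤-trans (m≤m+n j k) (m≤m+n (j + k) t))) , >⇒≢ (s≤s (m≤m+n (j + k) t))

  1≤run-last : 1 ≤ run (j + k) 0
  1≤run-last =
    proj₁ (proj₁ (proj₂ By) (position (j + k) 0) (s≤s z≤n) (within (position-≤ (j + k) {j} {0} {j₀} refl)))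

  run-last-lower-bound : ∀ {t} → t < j → suc t ≤ run (j + k) t
  run-last-lower-bound = Increasing⇒lower-bound increasing-last 1≤run-last

  ends-pair : ∀ {t s} → t + suc s ≡ j → run 0 t + run (j + k) s ≡ 2 * m + 1
  ends-pair = pair 0 j (j + k) (trans (+-comm j (j + k)) N≡)

  middle-pair : ∀ {t s} → t + suc s ≡ k → run j t + run j s ≡ 2 * m + 1
  middle-pair = pair j k j N≡

  pinned-ends : suc (j + k) ≤ run 0 0 →
                (∀ {t} → t < j → run 0 t ≡ position (j + k) t) ×
                (∀ {t} → t < j → run (j + k) t ≡ position 0 t)
  pinned-ends high =
    Increasing-pinned increasing-first increasing-last high 1≤run-last ends-pair (sums (identity₁ j₀ k)) ,
    Increasing-pinned increasing-last increasing-first 1≤run-last high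
      (λ {t} {s} split → trans (+-comm (run (j + k) t) (run 0 s)) (ends-pair (trans (+-suc-comm s t) split)))
      (sums (identity₂ j₀ k))
    where
    sums : ∀ {a} → a ≡ suc (j + k + j + 1) → a ≡ suc (2 * m + 1)
    sums a≡ = trans a≡ (cong (λ N → suc (N + 1)) N≡)
    identity₁ : ∀ j₀ k → suc (suc j₀ + k) + 1 + suc j₀ ≡ suc (suc j₀ + k + suc j₀ + 1)
    identity₁ = solve-∀
    identity₂ : ∀ j₀ k → 1 + suc (suc j₀ + k) + suc j₀ ≡ suc (suc j₀ + k + suc j₀ + 1)
    identity₂ = solve-∀

  pinned-middle : suc j ≤ run j 0 → ∀ {t} → t < k → run j t ≡ position j t
  pinned-middle high = Increasing-pinned increasing-middle increasing-middle high high middle-pair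
    (trans (identity j₀ k) (cong (λ N → suc (N + 1)) N≡))
    where
    identity : ∀ j₀ k → suc (suc j₀) + suc (suc j₀) + k ≡ suc (suc j₀ + k + suc j₀ + 1)
    identity = solve-∀

  reversal : List ℕ
  reversal = map (y !_) (blockReversal j k)

  reversal-B : B m reversal
  reversal-B = B-∘ {m} {blockReversal j k} {y} (blockReversal-B {m} {j} {k} N≡) By

  runs-y : applyUpTo (run 0) j ++ applyUpTo (run j) k ++ applyUpTo (run (j + k)) j ≡ y
  runs-y = begin
    applyUpTo (run 0) j ++ applyUpTo (run j) k ++ applyUpTo (run (j + k)) j
      ≡⟨ ++-assoc (applyUpTo (run 0) j) _ _ ⟨
    (applyUpTo (run 0) j ++ applyUpTo (run j) k) ++ applyUpTo (run (j + k)) j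
      ≡⟨ cong (_++ applyUpTo (run (j + k)) j) (applyUpTo-+ (run 0) j k) ⟨
    applyUpTo (run 0) (j + k) ++ applyUpTo (run (j + k)) j
      ≡⟨ applyUpTo-+ (run 0) (j + k) j ⟨
    applyUpTo (run 0) (j + k + j)
      ≡⟨ cong (applyUpTo (run 0)) (trans N≡ (sym (proj₁ By))) ⟩
    applyUpTo (run 0) (length y)
      ≡⟨ applyUpTo-! y ⟩
    y ∎

  -- The head below is y_{j+k} when k > 0, and y_{j+k+j} when k = 0.
  pop-reversal : Connected _≤_ (just (run 0 0)) (head (applyDownFrom (run j) k ++ applyDownFrom (run (j + k)) j)) →
                 (0 < k → run j 0 ≤ run (j + k) j₀) → pop reversal ≡ y
  pop-reversal junction₁ junction₂ = begin
    pop (map (y !_) (blockReversal j k))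
      ≡⟨ cong pop (map-blockReversal j k (y !_)) ⟩
    pop (R₁ ++ R₂ ++ R₃)
      ≡⟨ pop-applyDownFrom-++ (run 0) j (R₂ ++ R₃) increasing-first (λ _ → junction₁) ⟩
    U₁ ++ pop (R₂ ++ R₃)
      ≡⟨ cong (U₁ ++_) (pop-applyDownFrom-++ (run j) k R₃ increasing-middle (λ 0<k → just (junction₂ 0<k))) ⟩
    U₁ ++ U₂ ++ pop R₃
      ≡⟨ cong (λ xs → U₁ ++ U₂ ++ pop xs) (++-identityʳ R₃) ⟨
    U₁ ++ U₂ ++ pop (R₃ ++ [])
      ≡⟨ cong (λ xs → U₁ ++ U₂ ++ xs)
              (pop-applyDownFrom-++ (run (j + k)) j [] increasing-last (λ _ → just-nothing)) ⟩
    U₁ ++ U₂ ++ U₃ ++ []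
      ≡⟨ cong (λ xs → U₁ ++ U₂ ++ xs) (++-identityʳ U₃) ⟩
    U₁ ++ U₂ ++ U₃
      ≡⟨ runs-y ⟩
    y ∎
    where
    R₁ R₂ R₃ U₁ U₂ U₃ : List ℕ
    R₁ = applyDownFrom (run 0) j
    R₂ = applyDownFrom (run j) k
    R₃ = applyDownFrom (run (j + k)) j
    U₁ = applyUpTo (run 0) j
    U₂ = applyUpTo (run j) k
    U₃ = applyUpTo (run (j + k)) j

  blockSwapped : suc (j + k) ≤ run 0 0 → (∀ {t} → t < k → run j t ≡ position j t) → BlockSwapped j k y
  blockSwapped high fixed = proj₁ (pinned-ends high) , fixed , proj₂ (pinned-ends high)

notInPopImage⇒BlockSwapped : ∀ {m y} → B m y → ∀ j₀ k → suc j₀ + k + suc j₀ ≡ 2 * m →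
  (∀ i → 1 ≤ i → i < 2 * m → i ≢ suc j₀ → i ≢ suc j₀ + k → y ! i < y ! suc i) →
  ¬ InPopImage m y → BlockSwapped (suc j₀) k y
notInPopImage⇒BlockSwapped {m} {y} By j₀ zero N≡ ascent notInPop = blockSwapped high λ ()
  where
  open RunReversal {m} {y} By j₀ zero N≡ ascent
  high : suc (j + 0) ≤ run 0 0
  high with run 0 0 ≤? run (j + 0) j₀
  ... | yes first≤last = ⊥-elim (notInPop (reversal , reversal-B , pop-reversal (just first≤last) λ ()))
  ... | no  first≰last = subst (_≤ run 0 0) (cong suc (sym (+-identityʳ j)))
                           (≤-<-trans (run-last-lower-bound ≤-refl) (≰⇒> first≰last))
notInPopImage⇒BlockSwapped {m} {y} By j₀ (suc k₀) N≡ ascent notInPop = blockSwapped high (pinned-middle middle-high)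
  where
  open RunReversal {m} {y} By j₀ (suc k₀) N≡ ascent
  sums≡ : run 0 0 + run (j + suc k₀) j₀ ≡ run j 0 + run j k₀
  sums≡ = trans (ends-pair refl) (sym (middle-pair refl))
  last<middle : run (j + suc k₀) j₀ < run j 0
  last<middle with run j 0 ≤? run (j + suc k₀) j₀
  ... | yes middle≤last =
    ⊥-elim (notInPop (reversal , reversal-B , pop-reversal (just first≤middle) λ _ → middle≤last))
    where
    first≤middle : run 0 0 ≤ run j k₀
    first≤middle = a+b≡c+d∧b≤d⇒c≤a (trans (+-comm (run j k₀) (run j 0)) (sym sums≡)) middle≤last
  ... | no  middle≰last = ≰⇒> middle≰last
  middle-high : suc j ≤ run j 0
  middle-high = ≤-<-trans (run-last-lower-bound ≤-refl) last<middle
  high : suc (j + suc k₀) ≤ run 0 0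
  high = subst (_≤ run 0 0) (cong suc (sym (+-suc j k₀)))
           (subst (_< run 0 0) (pinned-middle middle-high (n<1+n k₀))
             (a+b≡c+d∧b<d⇒c<a (trans sums≡ (+-comm (run j 0) (run j k₀))) last<middle))

!-extend : ∀ n y {i} → suc i ≤ length y → extend n y ! suc (suc i) ≡ suc (y ! suc i)
!-extend n y i<|y| =
  trans (!-++ˡ (map suc y) [ 2 * n ] (subst (_ ≤_) (sym (length-map suc y)) i<|y|)) (!-map suc y i<|y|)

!-extend-last : ∀ n y → extend n y ! suc (suc (length y)) ≡ 2 * n
!-extend-last n y = subst (λ i → (map suc y ++ [ 2 * n ]) ! i ≡ 2 * n)
  (trans (+-comm (length (map suc y)) 1) (cong suc (length-map suc y))) (!-++ʳ (map suc y) [ 2 * n ])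

module _ {A : Set} {P : A → Set} (P? : Decidable P) where
  filter-rejects-one : ∀ xs → suc (length (filter P? xs)) ≡ length xs →
                       ∃[ e ] e ∈ xs × ¬ P e × (∀ {e'} → e' ∈ xs → e' ≢ e → P e')
  filter-rejects-one (x ∷ xs) eq with P? x
  ... | yes px = let e , e∈xs , ¬pe , others = filter-rejects-one xs (suc-injective eq) in
    e , there e∈xs , ¬pe , λ { (here refl) _ → px ; (there e'∈xs) e'≢e → others e'∈xs e'≢e }
  ... | no ¬px = x , here refl , ¬px ,
    λ { (here refl) x≢x → contradiction refl x≢x ; (there e'∈xs) _ → All.lookup all-P e'∈xs }
    where
    all-P : All P xs
    all-P = subst (All P) (filter-complete P? (suc-injective eq)) (all-filter P? xs)

module _ (m₀ : ℕ) (y : List ℕ) (By : B (suc m₀) y) where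
  private
    n : ℕ
    n = suc (suc m₀)

    P? : Decidable (λ i → extend n y ! i < extend n y ! suc i)
    P? i = extend n y ! i <? extend n y ! suc i

    positions : List ℕ
    positions = map suc (upTo n)

    |positions| : length positions ≡ n
    |positions| = trans (length-map suc (upTo n)) (length-upTo n)

    within : ∀ {a} → a ≤ n → a ≤ length y
    within {a} a≤n = subst (a ≤_) (sym (proj₁ By)) (≤-trans a≤n n≤2m)
      where
      identity : ∀ m₀ → suc (m₀ + suc m₀) ≡ 2 * suc m₀
      identity = solve-∀
      n≤2m : n ≤ 2 * suc m₀
      n≤2m = subst (n ≤_) (identity m₀) (s≤s (m≤n+m (suc m₀) m₀))

  single-descent : upCount n (extend n y) ≡ suc m₀ →
                   ∃[ j₀ ] j₀ ≤ m₀ ×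
                           (∀ i → 1 ≤ i → i ≤ suc m₀ → i ≢ suc j₀ → y ! i < y ! suc i)
  single-descent count with filter-rejects-one P? positions (trans (cong suc count) (sym |positions|))
  ... | e , e∈ , ¬ascent-e , ascent-others with ∈-map⁻ suc e∈
  ...   | zero , _ , refl =
    contradiction (subst (1 <_) (sym (!-extend n y {0} (within (s≤s z≤n)))) (s≤s 1≤y₁)) ¬ascent-e
    where
    1≤y₁ : 1 ≤ y ! 1
    1≤y₁ = proj₁ (proj₁ (proj₂ By) 1 ≤-refl (s≤s z≤n))
  ...   | suc j₀ , j₀∈ , refl = j₀ , s≤s⁻¹ (s≤s⁻¹ (∈-upTo⁻ j₀∈)) , ascent
    where
    ascent : ∀ i → 1 ≤ i → i ≤ suc m₀ → i ≢ suc j₀ → y ! i < y ! suc i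
    ascent (suc i) _ i≤ i≢ =
      s≤s⁻¹ (subst₂ _<_ (!-extend n y (within (≤-trans (n≤1+n _) (s≤s i≤))))
                        (!-extend n y (within (s≤s i≤)))
                        (ascent-others (∈-map⁺ suc (∈-upTo⁺ (s≤s i≤))) (i≢ ∘ suc-injective)))

B-extend-ascents : ∀ {m y j k} → B m y → j + k + j ≡ 2 * m →
            (∀ i → 1 ≤ i → i ≤ m → i ≢ j → y ! i < y ! suc i) →
            ∀ i → 1 ≤ i → i < 2 * m → i ≢ j → i ≢ j + k → y ! i < y ! suc i
B-extend-ascents {m} {y} {j} {k} By N≡ ascent i 1≤i i<2m i≢j i≢j+k with i ≤? m
... | yes i≤m = ascent i 1≤i i≤m i≢j
... | no  i≰m with i' , i+i'≡ ← m≤n⇒∃[o]m+o≡n (<⇒≤ i<2m) =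
  B-ascent-mirror {m} {y} By 1≤i' 1≤i (trans (+-comm i' i) i+i'≡) (ascent i' 1≤i' (<⇒≤ i'<m) i'≢j)
  where
  1≤i' : 1 ≤ i'
  1≤i' = a+b≡c+d∧b<d⇒c<a (trans (+-comm i' i) i+i'≡) i<2m
  i'<m : i' < m
  i'<m = a+b≡c+d∧b<d⇒c<a (trans (m+m≡2m m) (trans (sym i+i'≡) (+-comm i i'))) (≰⇒> i≰m)
    where
    m+m≡2m : ∀ m → m + m ≡ 2 * m
    m+m≡2m = solve-∀
  i'≢j : i' ≢ j
  i'≢j refl = i≢j+k (+-cancelʳ-≡ j i (j + k) (trans i+i'≡ (sym N≡)))

module ExtendBlockSwapped (n j k : ℕ) (y : List ℕ) (|y|≡ : length y ≡ j + k + j)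
  (2n≡ : 2 * n ≡ suc (suc (j + k + j))) (swapped : BlockSwapped j k y) where
  private
    within : ∀ {a} → a ≤ j + k + j → a ≤ length y
    within {a} a≤ = subst (a ≤_) (sym |y|≡) a≤

    2n∸j≡ : 2 * n ∸ j ≡ suc (suc (j + k))
    2n∸j≡ = trans (cong (_∸ j) 2n≡) (m+n∸n≡m (suc (suc (j + k))) j)

  extend-first-run : ∀ i → 2 ≤ i → i ≤ j + 1 → extend n y ! i ≡ (2 * n + i) ∸ (j + 2)
  extend-first-run (suc (suc t)) (s≤s (s≤s _)) i≤j+1 = begin
    extend n y ! suc (suc t)
      ≡⟨ !-extend n y (within (≤-trans t<j (≤-trans (m≤m+n j k) (m≤m+n (j + k) j)))) ⟩
    suc (y ! position 0 t)
      ≡⟨ cong suc (proj₁ swapped t<j) ⟩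
    suc (position (j + k) t)
      ≡⟨ m+n∸n≡m _ (j + 2) ⟨
    (suc (position (j + k) t) + (j + 2)) ∸ (j + 2)
      ≡⟨ cong (_∸ (j + 2)) (trans (identity j k t) (cong (_+ suc (suc t)) (sym 2n≡))) ⟩
    (2 * n + suc (suc t)) ∸ (j + 2) ∎
    where
    t<j : t < j
    t<j = s≤s⁻¹ (subst (suc (suc t) ≤_) (+-comm j 1) i≤j+1)
    identity : ∀ j k t → suc (suc (j + k + t)) + (j + 2) ≡ suc (suc (j + k + j)) + suc (suc t)
    identity = solve-∀

  extend-middle-run : ∀ i → j + 2 ≤ i → i ≤ 2 * n ∸ j ∸ 1 → extend n y ! i ≡ i
  extend-middle-run i j+2≤i i≤ with t , refl ← m≤n⇒∃[o]m+o≡n j+2≤i = begin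
    extend n y ! (j + 2 + t)           ≡⟨ cong (extend n y !_) i≡ ⟩
    extend n y ! suc (position j t)    ≡⟨ !-extend n y (within (≤-trans (+-monoʳ-< j t<k) (m≤m+n (j + k) j))) ⟩
    suc (y ! position j t)             ≡⟨ cong suc (proj₁ (proj₂ swapped) t<k) ⟩
    suc (position j t)                 ≡⟨ i≡ ⟨
    j + 2 + t                          ∎
    where
    i≡ : j + 2 + t ≡ suc (position j t)
    i≡ = identity j t
      where
      identity : ∀ j t → j + 2 + t ≡ suc (suc (j + t))
      identity = solve-∀
    t<k : t < k
    t<k = +-cancelˡ-< j t k (s≤s⁻¹ (subst₂ _≤_ i≡ (cong (_∸ 1) 2n∸j≡) i≤))

  extend-last-run : ∀ i → 2 * n ∸ j ≤ i → i ≤ 2 * n ∸ 1 → extend n y ! i ≡ (j + i + 2) ∸ 2 * n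
  extend-last-run i 2n∸j≤i i≤ with t , refl ← m≤n⇒∃[o]m+o≡n (subst (_≤ i) 2n∸j≡ 2n∸j≤i) = begin
    extend n y ! suc (position (j + k) t)     ≡⟨ !-extend n y (within (+-monoʳ-< (j + k) t<j)) ⟩
    suc (y ! position (j + k) t)              ≡⟨ cong suc (proj₂ (proj₂ swapped) t<j) ⟩
    suc (suc t)                               ≡⟨ m+n∸n≡m _ (2 * n) ⟨
    (suc (suc t) + 2 * n) ∸ 2 * n             ≡⟨ cong (λ N → (suc (suc t) + N) ∸ 2 * n) 2n≡ ⟩
    (suc (suc t) + suc (suc (j + k + j))) ∸ 2 * n  ≡⟨ cong (_∸ 2 * n) (identity j k t) ⟩
    (j + suc (position (j + k) t) + 2) ∸ 2 * n ∎
    where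
    t<j : t < j
    t<j = +-cancelˡ-< (j + k) t j (s≤s⁻¹ (subst (suc (suc (j + k + t)) ≤_) (cong (_∸ 1) 2n≡) i≤))
    identity : ∀ j k t → suc (suc t) + suc (suc (j + k + j)) ≡ j + suc (suc (j + k + t)) + 2
    identity = solve-∀

  extend-end : extend n y ! (2 * n) ≡ 2 * n
  extend-end =
    subst (λ i → extend n y ! i ≡ 2 * n) (sym (trans 2n≡ (cong (suc ∘ suc) (sym |y|≡)))) (!-extend-last n y)

mainTheorem6 : (n : ℕ) → 2 ≤ n → (y : List ℕ) → B (n ∸ 1) y
    → InPopImage n (extend n y)
    → upCount n (extend n y) ≡ n ∸ 1
    → ¬ InPopImage (n ∸ 1) y
    → Σ ℕ (λ j → (1 ≤ j) × (j ≤ n ∸ 1)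
        × (extend n y ! 1 ≡ 1)
        × (∀ i → 2 ≤ i → i ≤ j + 1 → extend n y ! i ≡ (2 * n + i) ∸ (j + 2))
        × (∀ i → j + 2 ≤ i → i ≤ 2 * n ∸ j ∸ 1 → extend n y ! i ≡ i)
        × (∀ i → 2 * n ∸ j ≤ i → i ≤ 2 * n ∸ 1 → extend n y ! i ≡ (j + i + 2) ∸ 2 * n)
        × (extend n y ! (2 * n) ≡ 2 * n))
mainTheorem6 (suc zero) (s≤s ())
mainTheorem6 (suc (suc m₀)) _ y By _ count notInPop with j₀ , j₀≤m₀ , ascent ← single-descent m₀ y By count =
  suc j₀ , s≤s z≤n , s≤s j₀≤m₀ , refl , extend-first-run , extend-middle-run , extend-last-run , extend-end
  where
  d : ℕ
  d = m₀ ∸ j₀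
  N≡ : suc j₀ + (d + d) + suc j₀ ≡ 2 * suc m₀
  N≡ = trans (identity (suc j₀) d) (cong (λ m → 2 * suc m) (m+[n∸m]≡n j₀≤m₀))
    where
    identity : ∀ j d → j + (d + d) + j ≡ 2 * (j + d)
    identity = solve-∀
  |y|≡ : length y ≡ suc j₀ + (d + d) + suc j₀
  |y|≡ = trans (proj₁ By) (sym N≡)
  2n≡ : 2 * suc (suc m₀) ≡ suc (suc (suc j₀ + (d + d) + suc j₀))
  2n≡ = trans (identity m₀) (cong (suc ∘ suc) (sym N≡))
    where
    identity : ∀ m₀ → 2 * suc (suc m₀) ≡ suc (suc (2 * suc m₀))
    identity = solve-∀
  swapped : BlockSwapped (suc j₀) (d + d) y
  swapped = notInPopImage⇒BlockSwapped {suc m₀} {y} By j₀ (d + d) N≡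
              (B-extend-ascents {suc m₀} {y} By N≡ ascent) notInPop
  open ExtendBlockSwapped (suc (suc m₀)) (suc j₀) (d + d) y |y|≡ 2n≡ swapped
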